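{- Every Carmichael number with exactly three prime factors is a polygonal number. More precisely, if $m$ is a Carmichael number with exactly three prime factors, then for each prime divisor $p$ of $m$ there exists an even integer $h\ge6$ such that $m=P^h_p$.
   Context: A Carmichael number is a composite positive integer $m$ with $a^{m-1}\equiv1\pmod m$ for all integers $a$ coprime to $m$. For integers $h\ge1$ and $n\ge1$, the $h$-gonal number is $P^h_n=\frac12\bigl(n^2(h-2)-n(h-4)\bigr)$. -}

module Defs where

open import Data.Nat as ℕ using (ℕ; _≤_; _<_; _^_; _∸_; ∣_-_∣)
open import Data.Nat.Divisibility using (_∣_)
open import Data.Nat.Coprimality using (Coprime)
open import Data.Nat.Primality using (Prime)
open import Data.Integer as ℤ using (ℤ; +_)
open import Data.Product using (Σ; _×_; ∃)
open import Data.Sum using (_⊎_)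
open import Relation.Nullary using (¬_)
open import Relation.Binary.PropositionalEquality using (_≡_; _≢_)

record Carmichael (m : ℕ) : Set where
  field
    one<m     : 1 < m
    notPrime  : ¬ Prime m
    fermat    : ∀ a → Coprime a m → m ∣ ∣ a ^ (m ∸ 1) - 1 ∣

HasExactlyThreePrimeFactors : ℕ → Set
HasExactlyThreePrimeFactors m =
  Σ ℕ λ p → Σ ℕ λ q → Σ ℕ λ r →
    Prime p × Prime q × Prime r ×
    p ≢ q × p ≢ r × q ≢ r ×
    p ∣ m × q ∣ m × r ∣ m ×
    (∀ s → Prime s → s ∣ m → s ≡ p ⊎ s ≡ q ⊎ s ≡ r)

twicePolygonal : ℕ → ℕ → ℤ
twicePolygonal h n =
  ((+ n) ℤ.* (+ n)) ℤ.* ((+ h) ℤ.- (+ 2)) ℤ.- (+ n) ℤ.* ((+ h) ℤ.- (+ 4))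

-- m = P^h_n  (stated as 2m = 2 P^h_n, avoiding division by 2)
IsPolygonal : ℕ → ℕ → ℕ → Set
IsPolygonal m h n = (+ 2) ℤ.* (+ m) ≡ twicePolygonal h n

module Submission where

-- Let p be a prime factor of the Carmichael number m and write m = p M.  Carmichael numbers are
-- squarefree: if d² ∣ m then, with x = m / d, (1 + x)^(m-1) ≡ 1 + (m - 1) x (mod m) forces m ∣ x.
-- They also satisfy Korselt's condition p - 1 ∣ m - 1.  Every unit a modulo p lifts to a unit b
-- modulo m, so a^(m-1) ≡ 1 (mod p); by Fermat, a^r ≡ 1 for r = (m - 1) mod (p - 1), and r = 0
-- because x^r - 1 with 0 < r < p - 1 has too small a degree to vanish at all of 1, …, p - 1
-- modulo p: its (p - 1)-st finite difference vanishes, but modulo p it is ± (0^r - 1) = ∓ 1.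
-- Hence M = 1 + s (p - 1), where s ≥ 2 as m is neither p nor p².  Finally
-- 2 P^h_p = p ((h - 2) (p - 1) + 2), so m = P^h_p for h = 2 s + 2.

open import Defs
open import Data.Fin.Base using (Fin; zero; suc; toℕ; fromℕ; inject₁)
open import Data.Fin.Properties using (toℕ-fromℕ; toℕ-inject₁; toℕ<n)
import Data.Integer as ℤ
import Data.Integer.Divisibility.Signed as ℤ
import Data.Integer.Properties as ℤ
open import Data.Integer.Tactic.RingSolver using (solve-∀)
open import Data.Nat
open import Data.Nat.Combinatorics using (_C_; nCn≡1; nC1≡n; nCk+nC[k+1]≡[n+1]C[k+1])
open import Data.Nat.Coprimality using (Coprime; coprime-divisor)
open import Data.Nat.Divisibility
open import Data.Nat.DivMod
open import Data.Nat.Primality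
open import Data.Nat.Properties
import Data.Nat.Tactic.RingSolver as ℕ
open import Data.Product using (Σ; ∃-syntax; _×_; _,_)
open import Data.Sum using (inj₁; inj₂)
open import Data.Vec.Functional using (Vector)
open import Function using (_∘_)
open import Relation.Nullary using (¬_; contradiction)
open import Relation.Binary.PropositionalEquality

open import Algebra.Definitions.RawMonoid +-0-rawMonoid using () renaming (_×_ to _×ᵃ_)
open import Algebra.Definitions.RawSemiring +-*-rawSemiring using () renaming (_^_ to _^ᵃ_)
open import Algebra.Properties.CommutativeSemigroup +-commutativeSemigroup using (x∙yz≈y∙xz)
open import Algebra.Properties.CommutativeSemiring.Binomial +-*-commutativeSemiring
  using (binomialExpansion; theorem)
open import Algebra.Properties.Monoid.Sum +-0-monoid using (sum; sum-init-last; sum-cong-≗)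

∣∸⇒%≡% : ∀ {n m o} .{{_ : NonZero n}} → m ≤ o → n ∣ o ∸ m → m % n ≡ o % n
∣∸⇒%≡% {n} {m} {o} m≤o n∣o∸m = begin
  m % n              ≡⟨ %-remove-+ʳ m n∣o∸m ⟨
  (m + (o ∸ m)) % n  ≡⟨ cong (_% n) (m+[n∸m]≡n m≤o) ⟩
  o % n              ∎
  where open ≡-Reasoning

∣∣-∣⇒%≡% : ∀ {n} m o .{{_ : NonZero n}} → n ∣ ∣ m - o ∣ → m % n ≡ o % n
∣∣-∣⇒%≡% {n} m o n∣∣m-o∣ with ≤-total m o
... | inj₁ m≤o = ∣∸⇒%≡% m≤o (subst (n ∣_) (m≤n⇒∣m-n∣≡n∸m m≤o) n∣∣m-o∣)
... | inj₂ o≤m = sym (∣∸⇒%≡% o≤m (subst (n ∣_) (m≤n⇒∣n-m∣≡n∸m o≤m) n∣∣m-o∣))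

%≡%⇒∣∣-∣ : ∀ {n} m o .{{_ : NonZero n}} → m % n ≡ o % n → n ∣ ∣ m - o ∣
%≡%⇒∣∣-∣ {n} m o m%n≡o%n = divides ∣ m / n - o / n ∣ (begin
  ∣ m - o ∣                                  ≡⟨ cong₂ ∣_-_∣ (m≡m%n+[m/n]*n m n) (m≡m%n+[m/n]*n o n) ⟩
  ∣ m % n + m / n * n - o % n + o / n * n ∣  ≡⟨ cong (λ r → ∣ m % n + m / n * n - r + o / n * n ∣) m%n≡o%n ⟨
  ∣ m % n + m / n * n - m % n + o / n * n ∣  ≡⟨ ∣m+n-m+o∣≡∣n-o∣ (m % n) _ _ ⟩
  ∣ m / n * n - o / n * n ∣                  ≡⟨ *-distribʳ-∣-∣ n (m / n) (o / n) ⟨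
  ∣ m / n - o / n ∣ * n                      ∎)
  where open ≡-Reasoning

+-%-cong : ∀ {n a b c d} .{{_ : NonZero n}} →
           a % n ≡ b % n → c % n ≡ d % n → (a + c) % n ≡ (b + d) % n
+-%-cong {n} {a} {b} {c} {d} a≡b c≡d = begin
  (a + c) % n          ≡⟨ %-distribˡ-+ a c n ⟩
  (a % n + c % n) % n  ≡⟨ cong₂ (λ x y → (x + y) % n) a≡b c≡d ⟩
  (b % n + d % n) % n  ≡⟨ %-distribˡ-+ b d n ⟨
  (b + d) % n          ∎
  where open ≡-Reasoning

*-%-cong : ∀ {n a b c d} .{{_ : NonZero n}} →
           a % n ≡ b % n → c % n ≡ d % n → (a * c) % n ≡ (b * d) % n
*-%-cong {n} {a} {b} {c} {d} a≡b c≡d = begin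
  (a * c) % n            ≡⟨ %-distribˡ-* a c n ⟩
  (a % n * (c % n)) % n  ≡⟨ cong₂ (λ x y → (x * y) % n) a≡b c≡d ⟩
  (b % n * (d % n)) % n  ≡⟨ %-distribˡ-* b d n ⟨
  (b * d) % n            ∎
  where open ≡-Reasoning

^-%-cong : ∀ {n a b} .{{_ : NonZero n}} → a % n ≡ b % n → ∀ k → a ^ k % n ≡ b ^ k % n
^-%-cong a≡b zero    = refl
^-%-cong a≡b (suc k) = *-%-cong a≡b (^-%-cong a≡b k)

*-%-cancelˡ : ∀ {p x a b} .{{_ : NonZero p}} → Prime p → ¬ p ∣ x →
              (x * a) % p ≡ (x * b) % p → a % p ≡ b % p
*-%-cancelˡ {p} {x} {a} {b} p-prime p∤x xa≡xb
  with euclidsLemma x ∣ a - b ∣ p-prime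
         (subst (p ∣_) (sym (*-distribˡ-∣-∣ x a b)) (%≡%⇒∣∣-∣ (x * a) (x * b) xa≡xb))
... | inj₁ p∣x     = contradiction p∣x p∤x
... | inj₂ p∣∣a-b∣ = ∣∣-∣⇒%≡% a b p∣∣a-b∣

∣⇒coprime-suc : ∀ {d x} → d ∣ x → Coprime (suc x) d
∣⇒coprime-suc {x = x} d∣x {e} (e∣1+x , e∣d) =
  ∣1⇒≡1 (∣m+n∣m⇒∣n (subst (e ∣_) (+-comm 1 x) e∣1+x) (∣-trans e∣d d∣x))

coprime-*ʳ : ∀ {a b c} → Coprime a b → Coprime a c → Coprime a (b * c)
coprime-*ʳ {a} {b} a⊥b a⊥c {e} (e∣a , e∣bc) = a⊥c (e∣a , coprime-divisor e⊥b e∣bc)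
  where
  e⊥b : Coprime e b
  e⊥b (f∣e , f∣b) = a⊥b (∣-trans f∣e e∣a , f∣b)

prime∤⇒coprime : ∀ {p a} → Prime p → ¬ p ∣ a → Coprime a p
prime∤⇒coprime p-prime p∤a (e∣a , e∣p) with prime⇒irreducible p-prime e∣p
... | inj₁ e≡1  = e≡1
... | inj₂ refl = contradiction e∣a p∤a

-- Fermat's little theorem

×ᵃ≡* : ∀ c t → c ×ᵃ t ≡ c * t
×ᵃ≡* zero    t = refl
×ᵃ≡* (suc c) t = cong (t +_) (×ᵃ≡* c t)

^ᵃ≡^ : ∀ x n → x ^ᵃ n ≡ x ^ n
^ᵃ≡^ x zero    = refl
^ᵃ≡^ x (suc n) = cong (x *_) (^ᵃ≡^ x n)

∣-sum : ∀ {d n} (t : Vector ℕ n) → (∀ i → d ∣ t i) → d ∣ sum t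
∣-sum {n = zero}  t d∣t = _ ∣0
∣-sum {n = suc n} t d∣t = ∣m∣n⇒∣m+n (d∣t zero) (∣-sum (t ∘ suc) (d∣t ∘ suc))

[1+k]*[1+n]C[1+k]≡[1+n]*nCk : ∀ n k → suc k * (suc n C suc k) ≡ suc n * (n C k)
[1+k]*[1+n]C[1+k]≡[1+n]*nCk zero    zero    = refl
[1+k]*[1+n]C[1+k]≡[1+n]*nCk zero    (suc k) = *-zeroʳ (suc (suc k))
[1+k]*[1+n]C[1+k]≡[1+n]*nCk (suc n) zero    = begin
  1 * (suc (suc n) C 1)  ≡⟨ *-identityˡ _ ⟩
  suc (suc n) C 1        ≡⟨ nC1≡n (suc (suc n)) ⟩
  suc (suc n)            ≡⟨ *-identityʳ _ ⟨
  suc (suc n) * 1        ∎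
  where open ≡-Reasoning
[1+k]*[1+n]C[1+k]≡[1+n]*nCk (suc n) (suc k) = begin
  (2 + k) * ((2 + n) C (2 + k))
    ≡⟨ cong ((2 + k) *_) (nCk+nC[k+1]≡[n+1]C[k+1] (suc n) (suc k)) ⟨
  (2 + k) * (a + b)
    ≡⟨ distribute k a b ⟩
  a + (1 + k) * a + (2 + k) * b
    ≡⟨ cong₂ (λ u v → a + u + v) ([1+k]*[1+n]C[1+k]≡[1+n]*nCk n k)
                                  ([1+k]*[1+n]C[1+k]≡[1+n]*nCk n (suc k)) ⟩
  a + (1 + n) * (n C k) + (1 + n) * (n C suc k)
    ≡⟨ collect n a (n C k) (n C suc k) ⟩
  a + (1 + n) * (n C k + n C suc k)
    ≡⟨ cong (λ u → a + (1 + n) * u) (nCk+nC[k+1]≡[n+1]C[k+1] n k) ⟩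
  (2 + n) * a ∎
  where
  open ≡-Reasoning
  a b : ℕ
  a = suc n C suc k
  b = suc n C suc (suc k)
  distribute : ∀ k a b → (2 + k) * (a + b) ≡ a + (1 + k) * a + (2 + k) * b
  distribute = ℕ.solve-∀
  collect : ∀ n a c d → a + (1 + n) * c + (1 + n) * d ≡ a + (1 + n) * (c + d)
  collect = ℕ.solve-∀

prime∣pCk : ∀ {p k} → Prime p → 0 < k → k < p → p ∣ p C k
prime∣pCk {suc n} {suc k} p-prime _ k<p
  with euclidsLemma (suc k) (suc n C suc k) p-prime
         (divides (n C k) (trans ([1+k]*[1+n]C[1+k]≡[1+n]*nCk n k) (*-comm (suc n) _)))
... | inj₁ p∣k   = contradiction (∣⇒≤ p∣k) (<⇒≱ k<p)
... | inj₂ p∣pCk = p∣pCk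

[1+x]^p%p≡[x^p+1]%p : ∀ {p} x .{{_ : NonZero p}} → Prime p → suc x ^ p % p ≡ (x ^ p + 1) % p
[1+x]^p%p≡[x^p+1]%p {1}               x p-prime = contradiction p-prime ¬prime[1]
[1+x]^p%p≡[x^p+1]%p {p@(suc (suc n))} x p-prime = begin
  suc x ^ p % p                      ≡⟨ cong (_% p) expansion ⟩
  (first + sum (term ∘ suc)) % p     ≡⟨ cong (λ z → (first + z) % p) (sum-init-last (term ∘ suc)) ⟩
  (first + (sum middle + last)) % p  ≡⟨ cong (_% p) (x∙yz≈y∙xz first (sum middle) last) ⟩
  (sum middle + (first + last)) % p  ≡⟨ %-remove-+ˡ (first + last) (∣-sum middle p∣middle) ⟩
  (first + last) % p                 ≡⟨ cong₂ (λ a b → (a + b) % p) (*-identityˡ (x ^ p)) last≡1 ⟩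
  (x ^ p + 1) % p                    ∎
  where
  open ≡-Reasoning
  term : Fin (suc p) → ℕ
  term k = (p C toℕ k) * x ^ (p ∸ toℕ k)
  middle : Vector ℕ (suc n)
  middle i = term (suc (inject₁ i))
  first last : ℕ
  first = term zero
  last  = term (suc (fromℕ (suc n)))
  expansion : suc x ^ p ≡ sum term
  expansion = begin
    suc x ^ p                ≡⟨ ^ᵃ≡^ (suc x) p ⟨
    suc x ^ᵃ p               ≡⟨ theorem p 1 x ⟩
    binomialExpansion 1 x p  ≡⟨ sum-cong-≗ {suc p} binomialTerm≡term ⟩
    sum term                 ∎
    where
    binomialTerm≡term : ∀ k → (p C toℕ k) ×ᵃ (1 ^ᵃ toℕ k * x ^ᵃ (p ∸ toℕ k)) ≡ term k
    binomialTerm≡term k = trans (×ᵃ≡* (p C toℕ k) _) (cong ((p C toℕ k) *_)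
      (trans (cong₂ _*_ (trans (^ᵃ≡^ 1 (toℕ k)) (^-zeroˡ (toℕ k))) (^ᵃ≡^ x (p ∸ toℕ k))) (*-identityˡ _)))
  last≡1 : last ≡ 1
  last≡1 = begin
    last                   ≡⟨ cong (λ k → (p C k) * x ^ (p ∸ k)) (cong suc (toℕ-fromℕ (suc n))) ⟩
    (p C p) * x ^ (p ∸ p)  ≡⟨ cong₂ (λ c e → c * x ^ e) (nCn≡1 p) (n∸n≡0 p) ⟩
    1                      ∎
  p∣middle : ∀ i → p ∣ middle i
  p∣middle i = ∣m⇒∣m*n _ (prime∣pCk p-prime z<s (s<s i<1+n))
    where
    i<1+n : toℕ (inject₁ i) < suc n
    i<1+n = subst (_< suc n) (sym (toℕ-inject₁ i)) (toℕ<n i)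

x^p%p≡x%p : ∀ {p} x .{{_ : NonZero p}} → Prime p → x ^ p % p ≡ x % p
x^p%p≡x%p {suc n} zero    _       = refl
x^p%p≡x%p {p}     (suc x) p-prime = begin
  suc x ^ p % p    ≡⟨ [1+x]^p%p≡[x^p+1]%p x p-prime ⟩
  (x ^ p + 1) % p  ≡⟨ +-%-cong (x^p%p≡x%p x p-prime) refl ⟩
  (x + 1) % p      ≡⟨ cong (_% p) (+-comm x 1) ⟩
  suc x % p        ∎
  where open ≡-Reasoning

x^[p∸1]%p≡1%p : ∀ {p} x .{{_ : NonZero p}} → Prime p → ¬ p ∣ x → x ^ (p ∸ 1) % p ≡ 1 % p
x^[p∸1]%p≡1%p {suc n} x p-prime p∤x =
  *-%-cancelˡ p-prime p∤x (trans (x^p%p≡x%p x p-prime) (cong (_% suc n) (sym (*-identityʳ x))))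

x^[r+q*[p∸1]]%p≡x^r%p : ∀ {p} x r q .{{_ : NonZero p}} → Prime p → ¬ p ∣ x →
                         x ^ (r + q * (p ∸ 1)) % p ≡ x ^ r % p
x^[r+q*[p∸1]]%p≡x^r%p {p} x r q p-prime p∤x = begin
  x ^ (r + q * (p ∸ 1)) % p        ≡⟨ cong (_% p) (^-distribˡ-+-* x r (q * (p ∸ 1))) ⟩
  (x ^ r * x ^ (q * (p ∸ 1))) % p  ≡⟨ cong (λ e → (x ^ r * x ^ e) % p) (*-comm q (p ∸ 1)) ⟩
  (x ^ r * x ^ ((p ∸ 1) * q)) % p  ≡⟨ cong (λ y → (x ^ r * y) % p) (^-*-assoc x (p ∸ 1) q) ⟨
  (x ^ r * (x ^ (p ∸ 1)) ^ q) % p  ≡⟨ *-%-cong {a = x ^ r} refl (^-%-cong (x^[p∸1]%p≡1%p x p-prime p∤x) q) ⟩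
  (x ^ r * 1 ^ q) % p              ≡⟨ cong (λ y → (x ^ r * y) % p) (^-zeroˡ q) ⟩
  (x ^ r * 1) % p                  ≡⟨ cong (_% p) (*-identityʳ (x ^ r)) ⟩
  x ^ r % p                        ∎
  where open ≡-Reasoning

-- Finite differences

Δ : (ℕ → ℤ.ℤ) → ℕ → ℤ.ℤ
Δ f x = f (suc x) ℤ.- f x

data DegreeBelow : ℕ → (ℕ → ℤ.ℤ) → Set where
  vanishes : ∀ {f} → (∀ x → f x ≡ ℤ.0ℤ) → DegreeBelow 0 f
  Δ-below  : ∀ {n f} → DegreeBelow n (Δ f) → DegreeBelow (suc n) f

DegreeBelow-cong : ∀ {n f g} → f ≗ g → DegreeBelow n f → DegreeBelow n g
DegreeBelow-cong f≗g (vanishes f≡0) = vanishes (λ x → trans (sym (f≗g x)) (f≡0 x))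
DegreeBelow-cong f≗g (Δ-below Δf)   =
  Δ-below (DegreeBelow-cong (λ x → cong₂ ℤ._-_ (f≗g (suc x)) (f≗g x)) Δf)

DegreeBelow-+ : ∀ {n f g} → DegreeBelow n f → DegreeBelow n g → DegreeBelow n (λ x → f x ℤ.+ g x)
DegreeBelow-+ (vanishes f≡0) (vanishes g≡0) = vanishes (λ x → cong₂ ℤ._+_ (f≡0 x) (g≡0 x))
DegreeBelow-+ {f = f} {g} (Δ-below Δf) (Δ-below Δg) =
  Δ-below (DegreeBelow-cong (λ x → Δ-+ (f (suc x)) (g (suc x)) (f x) (g x)) (DegreeBelow-+ Δf Δg))
  where
  Δ-+ : ∀ a b c d → (a ℤ.- c) ℤ.+ (b ℤ.- d) ≡ (a ℤ.+ b) ℤ.- (c ℤ.+ d)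
  Δ-+ = solve-∀

DegreeBelow-suc : ∀ {n f} → DegreeBelow n f → DegreeBelow (suc n) f
DegreeBelow-suc (vanishes f≡0) = Δ-below (vanishes (λ x → cong₂ ℤ._-_ (f≡0 (suc x)) (f≡0 x)))
DegreeBelow-suc (Δ-below Δf)   = Δ-below (DegreeBelow-suc Δf)

DegreeBelow-mono : ∀ {m n f} → m ≤′ n → DegreeBelow m f → DegreeBelow n f
DegreeBelow-mono ≤′-refl        f<m = f<m
DegreeBelow-mono (≤′-step m≤′n) f<m = DegreeBelow-suc (DegreeBelow-mono m≤′n f<m)

DegreeBelow-shift : ∀ {n f} → DegreeBelow n f → DegreeBelow n (f ∘ suc)
DegreeBelow-shift (vanishes f≡0) = vanishes (f≡0 ∘ suc)
DegreeBelow-shift (Δ-below Δf)   = Δ-below (DegreeBelow-shift Δf)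

DegreeBelow-const : ∀ c → DegreeBelow 1 (λ _ → c)
DegreeBelow-const c = Δ-below (vanishes (λ _ → ℤ.+-inverseʳ c))

DegreeBelow-*id : ∀ {n g} → DegreeBelow n g → DegreeBelow (suc n) (λ x → ℤ.+ x ℤ.* g x)
DegreeBelow-*id {g = g} (vanishes g≡0) = Δ-below (vanishes λ x →
  trans (cong₂ (λ a b → ℤ.+ suc x ℤ.* a ℤ.- ℤ.+ x ℤ.* b) (g≡0 (suc x)) (g≡0 x))
        (a*0-b*0≡0 (ℤ.+ suc x) (ℤ.+ x)))
  where
  a*0-b*0≡0 : ∀ a b → a ℤ.* ℤ.0ℤ ℤ.- b ℤ.* ℤ.0ℤ ≡ ℤ.0ℤ
  a*0-b*0≡0 = solve-∀
DegreeBelow-*id {g = g} g<n@(Δ-below Δg) =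
  Δ-below (DegreeBelow-cong Δ[id*g] (DegreeBelow-+ (DegreeBelow-*id Δg) (DegreeBelow-shift g<n)))
  where
  product-rule : ∀ y a b → y ℤ.* (a ℤ.- b) ℤ.+ a ≡ (ℤ.1ℤ ℤ.+ y) ℤ.* a ℤ.- y ℤ.* b
  product-rule = solve-∀
  Δ[id*g] : ∀ x → ℤ.+ x ℤ.* Δ g x ℤ.+ g (suc x) ≡ Δ (λ y → ℤ.+ y ℤ.* g y) x
  Δ[id*g] x = trans (product-rule (ℤ.+ x) (g (suc x)) (g x))
                    (cong (λ y → y ℤ.* g (suc x) ℤ.- ℤ.+ x ℤ.* g x) (sym (ℤ.pos-+ 1 x)))

DegreeBelow-^ : ∀ d → DegreeBelow (suc d) (λ x → ℤ.+ (x ^ d))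
DegreeBelow-^ zero    = DegreeBelow-const ℤ.1ℤ
DegreeBelow-^ (suc d) =
  DegreeBelow-cong (λ x → sym (ℤ.pos-* x (x ^ d))) (DegreeBelow-*id (DegreeBelow-^ d))

DegreeBelow⇒∣at0 : ∀ {d n f} → DegreeBelow n f → (∀ j → 1 ≤ j → j ≤ n → d ℤ.∣ f j) → d ℤ.∣ f 0
DegreeBelow⇒∣at0                 (vanishes f≡0) _   = ℤ.divides ℤ.0ℤ (f≡0 0)
DegreeBelow⇒∣at0 {d} {suc n} {f} (Δ-below Δf)   d∣f = subst (d ℤ.∣_) (ℤ.neg-involutive (f 0))
  (ℤ.∣m⇒∣-m (ℤ.∣m+n∣m⇒∣n (DegreeBelow⇒∣at0 Δf d∣Δf) (d∣f 1 (s≤s z≤n) (s≤s z≤n))))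
  where
  d∣Δf : ∀ j → 1 ≤ j → j ≤ n → d ℤ.∣ Δ f j
  d∣Δf j 1≤j j≤n = ℤ.∣m∣n⇒∣m-n (d∣f (suc j) (s≤s z≤n) (s≤s j≤n)) (d∣f j 1≤j (m≤n⇒m≤1+n j≤n))

∣+x-1∣≡∣x-1∣ : ∀ x → ℤ.∣ ℤ.+ x ℤ.- ℤ.1ℤ ∣ ≡ ∣ x - 1 ∣
∣+x-1∣≡∣x-1∣ zero    = refl
∣+x-1∣≡∣x-1∣ (suc x) = sym (∣-∣-identityʳ x)

%≡1%⇒∣-1 : ∀ {n} x .{{_ : NonZero n}} → x % n ≡ 1 % n → ℤ.+ n ℤ.∣ ℤ.+ x ℤ.- ℤ.1ℤ
%≡1%⇒∣-1 {n} x x≡1 = ℤ.∣ᵤ⇒∣ (subst (n ∣_) (sym (∣+x-1∣≡∣x-1∣ x)) (%≡%⇒∣∣-∣ x 1 x≡1))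

j^r%n≡1%n⇒r≡0 : ∀ {n r} .{{_ : NonZero n}} → r < pred n →
                (∀ j → 1 ≤ j → j < n → j ^ r % n ≡ 1 % n) → r ≡ 0
j^r%n≡1%n⇒r≡0               {r = zero}  _     _     = refl
j^r%n≡1%n⇒r≡0 {n@(suc n-1)} {r = suc r} r<n-1 j^r≡1 =
  contradiction (∣⇒≤ (ℤ.∣⇒∣ᵤ n∣-1)) (<⇒≱ (s≤s (≤-trans (s≤s z≤n) r<n-1)))
  where
  f : ℕ → ℤ.ℤ
  f x = ℤ.+ (x ^ suc r) ℤ.- ℤ.1ℤ
  f<n-1 : DegreeBelow n-1 f
  f<n-1 = DegreeBelow-mono (≤⇒≤′ r<n-1) (DegreeBelow-+ (DegreeBelow-^ (suc r))
            (DegreeBelow-mono (≤⇒≤′ (s≤s z≤n)) (DegreeBelow-const ℤ.-1ℤ)))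
  n∣-1 : ℤ.+ n ℤ.∣ ℤ.-1ℤ
  n∣-1 = DegreeBelow⇒∣at0 f<n-1 (λ j 1≤j j≤n-1 → %≡1%⇒∣-1 (j ^ suc r) (j^r≡1 j 1≤j (s≤s j≤n-1)))

j^k%p≡1%p⇒[p∸1]∣k : ∀ {p k} .{{_ : NonZero p}} → Prime p →
                     (∀ j → 1 ≤ j → j < p → j ^ k % p ≡ 1 % p) → p ∸ 1 ∣ k
j^k%p≡1%p⇒[p∸1]∣k {1}                   p-prime _     = contradiction p-prime ¬prime[1]
j^k%p≡1%p⇒[p∸1]∣k {p@(suc (suc n))} {k} p-prime j^k≡1 =
  m%n≡0⇒n∣m k (suc n) (j^r%n≡1%n⇒r≡0 (m%n<n k (suc n)) j^r≡1)
  where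
  r : ℕ
  r = k % suc n
  j^r≡1 : ∀ j → 1 ≤ j → j < p → j ^ r % p ≡ 1 % p
  j^r≡1 j 1≤j j<p = begin
    j ^ r % p                        ≡⟨ x^[r+q*[p∸1]]%p≡x^r%p j r (k / suc n) p-prime p∤j ⟨
    j ^ (r + k / suc n * suc n) % p  ≡⟨ cong (λ e → j ^ e % p) (m≡m%n+[m/n]*n k (suc n)) ⟨
    j ^ k % p                        ≡⟨ j^k≡1 j 1≤j j<p ⟩
    1 % p                            ∎
    where
    open ≡-Reasoning
    p∤j : ¬ p ∣ j
    p∤j = >⇒∤ {{>-nonZero 1≤j}} j<p

-- Carmichael numbers

[1+x]^k≡1+k*x+x*x*c : ∀ x k → ∃[ c ] suc x ^ k ≡ 1 + (k * x + x * x * c)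
[1+x]^k≡1+k*x+x*x*c x zero    = 0 , cong suc (sym (*-zeroʳ (x * x)))
[1+x]^k≡1+k*x+x*x*c x (suc k) with c , eq ← [1+x]^k≡1+k*x+x*x*c x k =
  k + c + x * c , trans (cong (suc x *_) eq) (expand x k c)
  where
  expand : ∀ x k c → (1 + x) * (1 + (k * x + x * x * c)) ≡ 1 + ((1 + k) * x + x * x * (k + c + x * c))
  expand = ℕ.solve-∀

∣x*x∧∣[1+x]^k-1⇒∣k*x : ∀ {y} x k → y ∣ x * x → y ∣ ∣ suc x ^ k - 1 ∣ → y ∣ k * x
∣x*x∧∣[1+x]^k-1⇒∣k*x {y} x k y∣xx y∣[1+x]^k-1 with c , expansion ← [1+x]^k≡1+k*x+x*x*c x k =
  ∣m+n∣m⇒∣n (subst (y ∣_) (+-comm (k * x) _) y∣kx+xxc) (∣m⇒∣m*n c y∣xx)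
  where
  y∣kx+xxc : y ∣ k * x + x * x * c
  y∣kx+xxc = subst (y ∣_) (trans (cong (∣_- 1 ∣) expansion) (∣-∣-identityʳ _)) y∣[1+x]^k-1

carmichael⇒squarefree : ∀ {m d} → Carmichael m → 1 < d → ¬ d * d ∣ m
carmichael⇒squarefree {m} {d} carmichael 1<d (divides q m≡q*[d*d]) =
  contradiction (∣⇒≤ m∣x) (<⇒≱ (subst (x <_) (sym m≡x*d) (m<m*n x d 1<d)))
  where
  open Carmichael carmichael using (one<m) renaming (fermat to carmichael-fermat)
  x k : ℕ
  x = q * d
  k = m ∸ 1
  m≡x*d : m ≡ x * d
  m≡x*d = trans m≡q*[d*d] (sym (*-assoc q d d))
  instance
    x≢0 : NonZero x
    x≢0 = m*n≢0⇒m≢0 x {{subst NonZero m≡x*d (>-nonZero (<-trans z<s one<m))}}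
  1+x⊥m : Coprime (suc x) m
  1+x⊥m = subst (Coprime (suc x)) (sym m≡x*d)
                (coprime-*ʳ (∣⇒coprime-suc ∣-refl) (∣⇒coprime-suc (n∣m*n q)))
  m∣kx : m ∣ k * x
  m∣kx = ∣x*x∧∣[1+x]^k-1⇒∣k*x x k (subst (_∣ x * x) (sym m≡x*d) (*-monoʳ-∣ x (n∣m*n q)))
                                   (carmichael-fermat (suc x) 1+x⊥m)
  mx≡kx+x : m * x ≡ k * x + x
  mx≡kx+x = begin
    m * x          ≡⟨ cong (_* x) (m∸n+n≡m (<⇒≤ one<m)) ⟨
    (k + 1) * x    ≡⟨ *-distribʳ-+ x k 1 ⟩
    k * x + 1 * x  ≡⟨ cong (k * x +_) (*-identityˡ x) ⟩
    k * x + x      ∎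
    where open ≡-Reasoning
  m∣x : m ∣ x
  m∣x = ∣m+n∣m⇒∣n (subst (m ∣_) mx≡kx+x (m∣m*n x)) m∣kx

carmichael⇒a^[m∸1]%p≡1%p : ∀ {m p a} .{{_ : NonZero p}} → Carmichael m → Prime p → p ∣ m →
                            ¬ p ∣ a → a ^ (m ∸ 1) % p ≡ 1 % p
carmichael⇒a^[m∸1]%p≡1%p {m} {p} {zero}  _          _       _   p∤0 = contradiction (p ∣0) p∤0
carmichael⇒a^[m∸1]%p≡1%p {m} {p} {suc a} carmichael p-prime (divides M m≡M*p) p∤1+a = begin
  suc a ^ (m ∸ 1) % p  ≡⟨ ^-%-cong b≡1+a (m ∸ 1) ⟨
  b ^ (m ∸ 1) % p      ≡⟨ ∣∣-∣⇒%≡% (b ^ (m ∸ 1)) 1 (∣-trans p∣m (carmichael-fermat b b⊥m)) ⟩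
  1 % p                ∎
  where
  open ≡-Reasoning
  open Carmichael carmichael using () renaming (fermat to carmichael-fermat)
  1<p : 1 < p
  1<p = nonTrivial⇒n>1 p {{prime⇒nonTrivial p-prime}}
  p∣m : p ∣ m
  p∣m = subst (p ∣_) (sym m≡M*p) (n∣m*n M)
  p∤M : ¬ p ∣ M
  p∤M p∣M = carmichael⇒squarefree carmichael 1<p
    (subst (p * p ∣_) (trans (*-comm p M) (sym m≡M*p)) (*-monoʳ-∣ p p∣M))
  -- b ≡ a (mod p) and b ≡ 1 (mod M), so the Carmichael congruence applies to b.
  u b : ℕ
  u = M ^ (p ∸ 1)
  b = suc (u * a)
  b≡1+a : b % p ≡ suc a % p
  b≡1+a = +-%-cong {a = 1} refl
    (trans (*-%-cong (x^[p∸1]%p≡1%p M p-prime p∤M) refl) (cong (_% p) (*-identityˡ a)))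
  M∣u*a : M ∣ u * a
  M∣u*a = ∣m⇒∣m*n a (subst (M ∣_) (cong (M ^_) (suc-pred (p ∸ 1) {{>-nonZero (m<n⇒0<n∸m 1<p)}}))
                                   (m∣m*n _))
  p∤b : ¬ p ∣ b
  p∤b p∣b = p∤1+a (m%n≡0⇒n∣m (suc a) p (trans (sym b≡1+a) (n∣m⇒m%n≡0 b p p∣b)))
  b⊥m : Coprime b m
  b⊥m = subst (Coprime b) (sym m≡M*p)
              (coprime-*ʳ (∣⇒coprime-suc M∣u*a) (prime∤⇒coprime p-prime p∤b))

carmichael⇒[p∸1]∣[m∸1] : ∀ {m p} → Carmichael m → Prime p → p ∣ m → p ∸ 1 ∣ m ∸ 1
carmichael⇒[p∸1]∣[m∸1] {p = p} carmichael p-prime p∣m = j^k%p≡1%p⇒[p∸1]∣k p-prime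
  (λ j 1≤j j<p → carmichael⇒a^[m∸1]%p≡1%p carmichael p-prime p∣m (>⇒∤ {{>-nonZero 1≤j}} j<p))
  where
  instance
    p≢0 : NonZero p
    p≢0 = prime⇒nonZero p-prime

carmichael⇒m≡p*[1+s*[p∸1]] : ∀ {m p} → Carmichael m → Prime p → p ∣ m →
                              ∃[ s ] m ≡ p * suc (s * (p ∸ 1))
carmichael⇒m≡p*[1+s*[p∸1]] {p = zero} _ p-prime _ = contradiction p-prime ¬prime[0]
carmichael⇒m≡p*[1+s*[p∸1]] carmichael _ (divides zero m≡0) =
  contradiction (subst (1 <_) m≡0 (Carmichael.one<m carmichael)) λ ()
carmichael⇒m≡p*[1+s*[p∸1]] {m} {p@(suc n)} carmichael p-prime p∣m@(divides (suc M) m≡[1+M]*p) =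
  quotient n∣M , (begin
    m                           ≡⟨ m≡[1+M]*p ⟩
    suc M * p                   ≡⟨ *-comm (suc M) p ⟩
    p * suc M                   ≡⟨ cong (λ t → p * suc t) (m∣n⇒n≡quotient*m n∣M) ⟩
    p * suc (quotient n∣M * n)  ∎)
  where
  open ≡-Reasoning
  rearrange : ∀ n M → n + M * suc n ≡ n * suc M + M
  rearrange = ℕ.solve-∀
  n∣M : n ∣ M
  n∣M = ∣m+n∣m⇒∣n (subst (n ∣_) (trans (cong (_∸ 1) m≡[1+M]*p) (rearrange n M))
                                (carmichael⇒[p∸1]∣[m∸1] carmichael p-prime p∣m))
                  (m∣m*n (suc M))

carmichael-cofactor : ∀ {m p} → Carmichael m → Prime p → p ∣ m →
                      ∃[ s ] 2 ≤ s × m ≡ p * suc (s * (p ∸ 1))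
carmichael-cofactor {m} {p} carmichael p-prime p∣m with carmichael⇒m≡p*[1+s*[p∸1]] carmichael p-prime p∣m
... | zero , m≡p*1 =
  contradiction (subst Prime (sym (trans m≡p*1 (*-identityʳ p))) p-prime) (Carmichael.notPrime carmichael)
... | suc zero , m≡p*[1+1*[p∸1]] =
  contradiction (subst (p * p ∣_) (sym (trans m≡p*[1+1*[p∸1]] (cong (p *_) 1+1*[p∸1]≡p))) ∣-refl)
                (carmichael⇒squarefree carmichael (nonTrivial⇒n>1 p {{prime⇒nonTrivial p-prime}}))
  where
  1+1*[p∸1]≡p : suc (1 * (p ∸ 1)) ≡ p
  1+1*[p∸1]≡p = trans (cong suc (*-identityˡ (p ∸ 1)))
                      (m+[n∸m]≡n (>-nonZero⁻¹ p {{prime⇒nonZero p-prime}}))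
... | s@(suc (suc _)) , m≡p*[1+s*[p∸1]] = s , s≤s (s≤s z≤n) , m≡p*[1+s*[p∸1]]

-- Polygonal numbers

p*[1+s*[p∸1]]-isPolygonal : ∀ p s .{{_ : NonZero p}} → IsPolygonal (p * suc (s * (p ∸ 1))) (2 * suc s) p
p*[1+s*[p∸1]]-isPolygonal (suc n) s = begin
  ℤ.+ 2 ℤ.* ℤ.+ (suc n * suc (s * n))              ≡⟨ cong (ℤ._*_ (ℤ.+ 2)) p*[1+s*n]-cast ⟩
  ℤ.+ 2 ℤ.* ((ℤ.1ℤ ℤ.+ N) ℤ.* (ℤ.1ℤ ℤ.+ S ℤ.* N))  ≡⟨ identity S N ⟩
  twice-P (ℤ.1ℤ ℤ.+ N) (ℤ.+ 2 ℤ.* (ℤ.1ℤ ℤ.+ S))    ≡⟨ cong₂ twice-P (ℤ.pos-+ 1 n) h-cast ⟨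
  twicePolygonal (2 * suc s) (suc n)               ∎
  where
  open ≡-Reasoning
  N S : ℤ.ℤ
  N = ℤ.+ n
  S = ℤ.+ s
  twice-P : ℤ.ℤ → ℤ.ℤ → ℤ.ℤ
  twice-P P H = (P ℤ.* P) ℤ.* (H ℤ.- ℤ.+ 2) ℤ.- P ℤ.* (H ℤ.- ℤ.+ 4)
  p*[1+s*n]-cast : ℤ.+ (suc n * suc (s * n)) ≡ (ℤ.1ℤ ℤ.+ N) ℤ.* (ℤ.1ℤ ℤ.+ S ℤ.* N)
  p*[1+s*n]-cast = trans (ℤ.pos-* (suc n) (suc (s * n)))
    (cong₂ ℤ._*_ (ℤ.pos-+ 1 n) (trans (ℤ.pos-+ 1 (s * n)) (cong (ℤ._+_ ℤ.1ℤ) (ℤ.pos-* s n))))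
  h-cast : ℤ.+ (2 * suc s) ≡ ℤ.+ 2 ℤ.* (ℤ.1ℤ ℤ.+ S)
  h-cast = trans (ℤ.pos-* 2 (suc s)) (cong (ℤ._*_ (ℤ.+ 2)) (ℤ.pos-+ 1 s))
  identity : ∀ S N → ℤ.+ 2 ℤ.* ((ℤ.1ℤ ℤ.+ N) ℤ.* (ℤ.1ℤ ℤ.+ S ℤ.* N)) ≡
    ((ℤ.1ℤ ℤ.+ N) ℤ.* (ℤ.1ℤ ℤ.+ N)) ℤ.* (ℤ.+ 2 ℤ.* (ℤ.1ℤ ℤ.+ S) ℤ.- ℤ.+ 2)
      ℤ.- (ℤ.1ℤ ℤ.+ N) ℤ.* (ℤ.+ 2 ℤ.* (ℤ.1ℤ ℤ.+ S) ℤ.- ℤ.+ 4)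
  identity = solve-∀

corollary10p2 : (m : ℕ) → Carmichael m → HasExactlyThreePrimeFactors m →
    (p : ℕ) → Prime p → p ∣ m →
    Σ ℕ λ h → (Σ ℕ λ k → h ≡ 2 * k) × 6 ≤ h × IsPolygonal m h p
corollary10p2 m carmichael _ p p-prime p∣m
  with s , 2≤s , m≡p*[1+s*[p∸1]] ← carmichael-cofactor carmichael p-prime p∣m =
  2 * suc s , (suc s , refl) , *-monoʳ-≤ 2 (s≤s 2≤s) ,
  subst (λ n → IsPolygonal n (2 * suc s) p) (sym m≡p*[1+s*[p∸1]])
        (p*[1+s*[p∸1]]-isPolygonal p s {{prime⇒nonZero p-prime}})
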